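{- There exists a function $s:\mathbb{N}\to\mathbb{N}$ with $s(r)\in O(r)$ such that for every $r\in\mathbb{N}$ and every connected graph $G$ that has no $K_{1,r}$-minor, $G$ is a subdivision of a graph on at most $s(r)$ vertices.
   Context: A graph $G$ contains an $H$-minor if a graph isomorphic to $H$ can be obtained from $G$ by deleting vertices, deleting edges and contracting edges. $K_{1,r}$ is the star with $r$ leaves. $G$ is a subdivision of $H$ if a graph isomorphic to $G$ can be obtained from $H$ by replacing some edges of $H$ by paths. -}

module Defs where

open import Data.Nat using (ℕ; zero; suc)
open import Data.Fin using (Fin; zero; suc; inject₁; fromℕ; _≟_)
open import Data.Bool using (Bool; true; false; _∧_; _∨_; not)
open import Data.Maybe using (Maybe; just)
open import Data.Product using (Σ; ∃; _×_; _,_)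
open import Data.Unit using (⊤)
open import Relation.Nullary.Decidable using (⌊_⌋)
open import Relation.Binary.PropositionalEquality using (_≡_; refl)
open import Function.Bundles using (_⤖_; Bijection)

record Graph (n : ℕ) : Set where
  field
    adj   : Fin n → Fin n → Bool
    sym   : ∀ i j → adj i j ≡ adj j i
    irref : ∀ i → adj i i ≡ false
open Graph public

Edge : ∀ {n} → Graph n → Fin n → Fin n → Set
Edge G i j = adj G i j ≡ true

data WalkIn {n} (G : Graph n) (P : Fin n → Set) : Fin n → Fin n → Set where
  here : ∀ {u} → P u → WalkIn G P u u
  step : ∀ {u w v} → P u → Edge G u w → WalkIn G P w v → WalkIn G P u v

Connected : ∀ {n} → Graph n → Set
Connected {n} G = ∀ (u v : Fin n) → WalkIn G (λ _ → ⊤) u v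

-- Minor: a model of H in G.  Vertex v of G lies in branch set x iff
-- β v ≡ just x (so branch sets are automatically disjoint).
record MinorModel {h n} (H : Graph h) (G : Graph n) : Set where
  field
    β         : Fin n → Maybe (Fin h)
    nonempty  : ∀ x → ∃ λ v → β v ≡ just x
    connected : ∀ x u v → β u ≡ just x → β v ≡ just x →
                WalkIn G (λ w → β w ≡ just x) u v
    edges     : ∀ x y → Edge H x y →
                ∃ λ u → ∃ λ v → β u ≡ just x × β v ≡ just y × Edge G u v

HasMinor : ∀ {n h} → Graph n → Graph h → Set
HasMinor G H = MinorModel H G

starAdj : ∀ {r} → Fin (suc r) → Fin (suc r) → Bool
starAdj zero    zero    = false
starAdj zero    (suc _) = true
starAdj (suc _) zero    = true
starAdj (suc _) (suc _) = false

starSym : ∀ {r} (i j : Fin (suc r)) → starAdj i j ≡ starAdj j i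
starSym zero    zero    = refl
starSym zero    (suc _) = refl
starSym (suc _) zero    = refl
starSym (suc _) (suc _) = refl

starIrr : ∀ {r} (i : Fin (suc r)) → starAdj i i ≡ false
starIrr zero    = refl
starIrr (suc _) = refl

Star : (r : ℕ) → Graph (suc r)
Star r = record { adj = starAdj ; sym = starSym ; irref = starIrr }

_≅_ : ∀ {n m} → Graph n → Graph m → Set
_≅_ {n} {m} G H = Σ (Fin n ⤖ Fin m) λ f →
  ∀ i j → adj G i j ≡ adj H (Bijection.to f i) (Bijection.to f j)

-- G (on n+1 vertices) arises from G' (on n vertices) by subdividing one
-- edge uv of G' with a new vertex (the last vertex of G).
_==_ : ∀ {n} → Fin n → Fin n → Bool
i == j = ⌊ i ≟ j ⌋

SubdivStep : ∀ {n} → Graph n → Graph (suc n) → Set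
SubdivStep {n} G' G = Σ (Fin n) λ u → Σ (Fin n) λ v → Edge G' u v ×
  (∀ i j → adj G (inject₁ i) (inject₁ j)
           ≡ (adj G' i j ∧ not ((i == u ∧ j == v) ∨ (i == v ∧ j == u)))) ×
  (∀ i → adj G (fromℕ n) (inject₁ i) ≡ (i == u ∨ i == v))

data SubdivisionOf {m} (H : Graph m) : ∀ {n} → Graph n → Set where
  base : SubdivisionOf H H
  sub  : ∀ {n} {G' : Graph n} {G : Graph (suc n)} →
         SubdivisionOf H G' → SubdivStep G' G → SubdivisionOf H G
  iso  : ∀ {n k} {G' : Graph n} {G : Graph k} →
         SubdivisionOf H G' → G' ≅ G → SubdivisionOf H G

{-# OPTIONS --safe #-}

-- A vertex of degree two with non-adjacent neighbours can be suppressed: the graph is a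
-- subdivision of the smaller graph, which is still connected and has no new minors.  By
-- induction on the number of vertices we may therefore assume that no vertex is
-- suppressible, and have to show n ≤ 5r.  Grow a connected vertex set S from a root, in the
-- style of Kleitman and West, and weigh every vertex: 0 inside S, 1 if undiscovered (not in
-- S and not adjacent to it), and, on the frontier, 3 while it still has an undiscovered
-- neighbour and 5 afterwards.  Initially n ≤ 1 + total weight.  Absorbing a frontier vertex
-- (sometimes together with an undiscovered neighbour) never lowers the total weight, and a
-- case analysis shows that such a step exists as long as something is undiscovered, unless
-- a suppressible vertex turns up.  At the end the total weight is at most 5 times the size
-- of the frontier, and contracting S gives a star minor with the frontier as leaves.
module Submission where

open import Defs hiding (sym)
open import Data.Bool using (Bool; true; false; _∧_; _∨_; not; if_then_else_)
open import Data.Bool.Properties using (∨-zeroʳ; ∨-comm; ∧-comm; ¬-not) renaming (_≟_ to _≟ᵇ_)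
open import Data.Fin using (Fin; zero; suc; inject₁; fromℕ; _≟_)
open import Data.Fin.Permutation using (Permutation; _⟨$⟩ʳ_; _⟨$⟩ˡ_; inverseˡ; inverseʳ; transpose)
open import Data.Fin.Properties using (suc-injective; any?; inject₁-injective)
open import Data.Fin.Relation.Unary.Top using (view; ‵fromℕ; ‵inject₁; view-inject₁; view-fromℕ)
open import Data.Maybe using (Maybe; just; nothing)
open import Data.Nat using (ℕ; zero; suc; _≤_; _<_; _*_; _+_; z≤n; s≤s; _≤?_)
open import Data.Nat.Induction using (<-wellFounded)
open import Data.Nat.Properties hiding (suc-injective; _≟_)
open import Data.Product using (Σ; ∃; ∃₂; _×_; _,_; proj₁; proj₂)
open import Data.Sum using (_⊎_; inj₁; inj₂)
open import Data.Unit using (⊤; tt)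
open import Data.Vec.Functional using (_∷_)
open import Function using (_∘_)
open import Function.Definitions using (Injective)
open import Function.Properties.Inverse using (↔⇒⤖)
open import Induction.WellFounded using (Acc; acc)
open import Relation.Binary.PropositionalEquality
open import Relation.Nullary using (¬_; Dec; yes; no; does; contradiction; ¬?; _×-dec_)
open import Relation.Nullary.Decidable using (dec-true; dec-false; decidable-stable)
open import Relation.Unary using (Decidable)
open import Algebra.Properties.Semiring.Sum +-*-semiring
  using (sum; ∑-distrib-+; *-distribˡ-sum; sum-replicate-zero)

==-refl : ∀ {n} (i : Fin n) → (i == i) ≡ true
==-refl i with i ≟ i
... | yes _  = refl
... | no i≢i = contradiction refl i≢i

==⇒≡ : ∀ {n} {i j : Fin n} → (i == j) ≡ true → i ≡ j
==⇒≡ {i = i} {j} eq with i ≟ j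
... | yes i≡j = i≡j

==-cong : ∀ {n m} {i j : Fin n} {k l : Fin m} →
          (i ≡ j → k ≡ l) → (k ≡ l → i ≡ j) → (i == j) ≡ (k == l)
==-cong {i = i} {j} {k} {l} to from with i ≟ j | k ≟ l
... | yes _   | yes _   = refl
... | no _    | no _    = refl
... | yes i≡j | no k≢l  = contradiction (to i≡j) k≢l
... | no i≢j  | yes k≡l = contradiction (from k≡l) i≢j

∨-true⁻ : ∀ a {b} → a ∨ b ≡ true → a ≡ true ⊎ b ≡ true
∨-true⁻ true  _ = inj₁ refl
∨-true⁻ false p = inj₂ p

∧-true⁻ : ∀ a {b} → a ∧ b ≡ true → a ≡ true × b ≡ true
∧-true⁻ true p = refl , p

module _ {n} (G : Graph n) where

  edge-sym : ∀ {a b} → Edge G a b → Edge G b a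
  edge-sym {a} {b} e = trans (Graph.sym G b a) e

  edge-irrefl : ∀ {a b} → Edge G a b → a ≢ b
  edge-irrefl {a} e refl with () ← trans (sym e) (Graph.irref G a)

module _ {n} {G : Graph n} where

  module _ {P : Fin n → Set} where

    walk-head : ∀ {a b} → WalkIn G P a b → P a
    walk-head (here p)     = p
    walk-head (step p _ _) = p

    walk-last : ∀ {a b} → WalkIn G P a b → P b
    walk-last (here p)     = p
    walk-last (step _ _ w) = walk-last w

    walk-++ : ∀ {a b c} → WalkIn G P a b → WalkIn G P b c → WalkIn G P a c
    walk-++ (here _)     w′ = w′
    walk-++ (step p e w) w′ = step p e (walk-++ w w′)

    walk-snoc : ∀ {a b c} → WalkIn G P a b → Edge G b c → P c → WalkIn G P a c
    walk-snoc w e pc = walk-++ w (step (walk-last w) e (here pc))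

    walk-reverse : ∀ {a b} → WalkIn G P a b → WalkIn G P b a
    walk-reverse (here p)     = here p
    walk-reverse (step p e w) = walk-snoc (walk-reverse w) (edge-sym G e) p

    walk-crossing : ∀ {Q : Fin n → Set} → Decidable Q → ∀ {a b} → WalkIn G P a b →
                    ¬ Q a → Q b → ∃₂ λ p q → ¬ Q p × Q q × Edge G p q
    walk-crossing Q? (here _) ¬qa qb = contradiction qb ¬qa
    walk-crossing Q? (step {w = c} _ e w) ¬qa qb with Q? c
    ... | yes qc = _ , c , ¬qa , qc , e
    ... | no ¬qc = walk-crossing Q? w ¬qc qb

walk-map : ∀ {n k} {G : Graph n} {G′ : Graph k} {P : Fin n → Set} {Q : Fin k → Set}
  (f : Fin n → Fin k) → (∀ {z} → P z → Q (f z)) →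
  (∀ {p q} → P p → P q → Edge G p q → WalkIn G′ Q (f p) (f q)) →
  ∀ {a b} → WalkIn G P a b → WalkIn G′ Q (f a) (f b)
walk-map f pred edge (here p)     = here (pred p)
walk-map f pred edge (step p e w) = walk-++ (edge p (walk-head w) e) (walk-map f pred edge w)

walk-weaken : ∀ {n} {G : Graph n} {P Q : Fin n → Set} → (∀ {z} → P z → Q z) →
  ∀ {a b} → WalkIn G P a b → WalkIn G Q a b
walk-weaken pq = walk-map (λ z → z) pq (λ p q e → step (pq p) e (here (pq q)))

sum-mono : ∀ {n} {f g : Fin n → ℕ} → (∀ i → f i ≤ g i) → sum f ≤ sum g
sum-mono {zero}  _   = z≤n
sum-mono {suc n} f≤g = +-mono-≤ (f≤g zero) (sum-mono (f≤g ∘ suc))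

sum-mono-< : ∀ {n} {f g : Fin n → ℕ} → (∀ i → f i ≤ g i) → ∀ a → f a < g a → sum f < sum g
sum-mono-< f≤g zero    fa<ga = +-mono-<-≤ fa<ga (sum-mono (f≤g ∘ suc))
sum-mono-< f≤g (suc a) fa<ga = +-mono-≤-< (f≤g zero) (sum-mono-< (f≤g ∘ suc) a fa<ga)

sum-ones : ∀ n → sum {n} (λ _ → 1) ≡ n
sum-ones zero    = refl
sum-ones (suc n) = cong suc (sum-ones n)

sum-exchange : ∀ {n} {f g p q : Fin n → ℕ} →
  (∀ i → f i + p i ≤ g i + q i) → sum q ≤ sum p → sum f ≤ sum g
sum-exchange {f = f} {g} {p} {q} pointwise Σq≤Σp = +-cancelʳ-≤ (sum p) (sum f) (sum g) (begin
  sum f + sum p               ≡⟨ ∑-distrib-+ f p ⟨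
  sum (λ i → f i + p i)       ≤⟨ sum-mono pointwise ⟩
  sum (λ i → g i + q i)       ≡⟨ ∑-distrib-+ g q ⟩
  sum g + sum q               ≤⟨ +-monoʳ-≤ (sum g) Σq≤Σp ⟩
  sum g + sum p               ∎)
  where open ≤-Reasoning

δ : ∀ {n} → Fin n → ℕ → Fin n → ℕ
δ a c i = if does (i ≟ a) then c else 0

δ-self : ∀ {n} (a : Fin n) c → δ a c a ≡ c
δ-self a c rewrite dec-true (a ≟ a) refl = refl

δ-other : ∀ {n} {a i : Fin n} c → i ≢ a → δ a c i ≡ 0
δ-other {a = a} {i} c i≢a rewrite dec-false (i ≟ a) i≢a = refl

sum-δ : ∀ {n} (a : Fin n) c → sum (δ a c) ≡ c
sum-δ {suc n} zero    c = trans (cong (c +_) (sum-replicate-zero n)) (+-identityʳ c)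
sum-δ {suc n} (suc a) c = sum-δ a c

indicator : ∀ {A : Set} → Dec A → ℕ
indicator a? = if does a? then 1 else 0

indicator-mono : ∀ {A B : Set} → (A → B) → (a? : Dec A) (b? : Dec B) → indicator a? ≤ indicator b?
indicator-mono A⇒B (yes a) (no ¬b) = contradiction (A⇒B a) ¬b
indicator-mono A⇒B (yes _) (yes _) = ≤-refl
indicator-mono A⇒B (no _)  _       = z≤n

indicator-< : ∀ {A B : Set} → ¬ A → B → (a? : Dec A) (b? : Dec B) → indicator a? < indicator b?
indicator-< ¬a b (yes a) _      = contradiction a ¬a
indicator-< ¬a b (no _) (yes _) = ≤-refl
indicator-< ¬a b (no _) (no ¬b) = contradiction b ¬b

count : ∀ {n} {P : Fin n → Set} → Decidable P → ℕ
count P? = sum (indicator ∘ P?)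

count-mono-< : ∀ {n} {P Q : Fin n → Set} (P? : Decidable P) (Q? : Decidable Q) →
  (∀ {i} → P i → Q i) → ∀ {a} → Q a → ¬ P a → count P? < count Q?
count-mono-< P? Q? P⊆Q {a} qa ¬pa =
  sum-mono-< (λ i → indicator-mono P⊆Q (P? i) (Q? i)) a (indicator-< ¬pa qa (P? a) (Q? a))

pick : ∀ {n} {P : Fin n → Set} (P? : Decidable P) {r} → r ≤ count P? →
       Σ (Fin r → Fin n) λ ℓ → Injective _≡_ _≡_ ℓ × (∀ k → P (ℓ k))
pick P? {zero} _ = (λ ()) , (λ { {()} }) , (λ ())
pick {suc n} {P} P? {suc r} r≤ with P? zero
... | no _ =
  let ℓ , ℓ-inj , ℓ-P = pick (P? ∘ suc) r≤ in suc ∘ ℓ , ℓ-inj ∘ suc-injective , ℓ-P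
... | yes p0 =
  let ℓ , ℓ-inj , ℓ-P = pick (P? ∘ suc) (≤-pred r≤) in zero ∷ suc ∘ ℓ , ∷-inj ℓ-inj , ∷-P ℓ-P
  where
  ∷-inj : ∀ {ℓ : Fin r → Fin n} → Injective _≡_ _≡_ ℓ → Injective _≡_ _≡_ (zero ∷ suc ∘ ℓ)
  ∷-inj ℓ-inj {zero}  {zero}   _ = refl
  ∷-inj ℓ-inj {suc k} {suc k′} e = cong suc (ℓ-inj (suc-injective e))
  ∷-P : ∀ {ℓ : Fin r → Fin n} → (∀ k → P (suc (ℓ k))) → ∀ k → P ((zero ∷ suc ∘ ℓ) k)
  ∷-P ℓ-P zero    = p0
  ∷-P ℓ-P (suc k) = ℓ-P k

-- Stated in the Boolean form of SubdivStep, with w as the subdividing vertex.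
SuppressibleAt : ∀ {n} → Graph n → Fin n → Fin n → Fin n → Set
SuppressibleAt G w u v = u ≢ v × (∀ i → adj G w i ≡ (i == u ∨ i == v)) × adj G u v ≡ false

Suppressible : ∀ {n} → Graph n → Set
Suppressible G = ∃ λ w → ∃₂ λ u v → SuppressibleAt G w u v

record Suppression {m} (G : Graph (suc m)) : Set where
  field
    graph       : Graph m
    connected   : Connected G → Connected graph
    minor       : ∀ {h} {H : Graph h} → HasMinor graph H → HasMinor G H
    subdivision : ∀ {h} {H : Graph h} → SubdivisionOf H graph → SubdivisionOf H G

relabel : ∀ {n} → Graph n → Permutation n n → Graph n
relabel G π = record
  { adj   = λ i j → adj G (π ⟨$⟩ʳ i) (π ⟨$⟩ʳ j)
  ; sym   = λ i j → Graph.sym G (π ⟨$⟩ʳ i) (π ⟨$⟩ʳ j)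
  ; irref = λ i → Graph.irref G (π ⟨$⟩ʳ i)
  }

module _ {n} (G : Graph n) (π : Permutation n n) where

  relabel-≅ : relabel G π ≅ G
  relabel-≅ = ↔⇒⤖ π , λ i j → refl

  relabel-connected : Connected G → Connected (relabel G π)
  relabel-connected conn a b =
    subst₂ (WalkIn (relabel G π) _) (inverseˡ π) (inverseˡ π)
      (walk-map (π ⟨$⟩ˡ_) (λ _ → tt) (λ _ _ e → step tt (edge e) (here tt))
                (conn (π ⟨$⟩ʳ a) (π ⟨$⟩ʳ b)))
    where
    edge : ∀ {p q} → Edge G p q → Edge (relabel G π) (π ⟨$⟩ˡ p) (π ⟨$⟩ˡ q)
    edge = subst₂ (Edge G) (sym (inverseʳ π)) (sym (inverseʳ π))

  relabel-minor : ∀ {h} {H : Graph h} → HasMinor (relabel G π) H → HasMinor G H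
  relabel-minor M = record
    { β         = β ∘ (π ⟨$⟩ˡ_)
    ; nonempty  = λ y → let v , βv = nonempty y in π ⟨$⟩ʳ v , back βv
    ; connected = λ y p q βp βq →
        subst₂ (WalkIn G _) (inverseʳ π) (inverseʳ π)
          (walk-map (π ⟨$⟩ʳ_) back (λ βs βt e → step (back βs) e (here (back βt)))
                    (connected y _ _ βp βq))
    ; edges     = λ y z e → let s , t , βs , βt , st = edges y z e in
        π ⟨$⟩ʳ s , π ⟨$⟩ʳ t , back βs , back βt , st
    }
    where
    open MinorModel M
    back : ∀ {v y} → β v ≡ just y → β (π ⟨$⟩ˡ (π ⟨$⟩ʳ v)) ≡ just y
    back = trans (cong β (inverseˡ π))

  relabel-suppressible : ∀ {w u v} → SuppressibleAt G w u v →
    SuppressibleAt (relabel G π) (π ⟨$⟩ˡ w) (π ⟨$⟩ˡ u) (π ⟨$⟩ˡ v)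
  relabel-suppressible {w} {u} {v} (u≢v , adj-w , ¬uv) = u≢v ∘ from-injective , adj-w′ , ¬uv′
    where
    from-injective : ∀ {a b} → π ⟨$⟩ˡ a ≡ π ⟨$⟩ˡ b → a ≡ b
    from-injective eq = trans (sym (inverseʳ π)) (trans (cong (π ⟨$⟩ʳ_) eq) (inverseʳ π))
    moved : ∀ i a → ((π ⟨$⟩ʳ i) == a) ≡ (i == (π ⟨$⟩ˡ a))
    moved i a = ==-cong (λ { refl → sym (inverseˡ π) }) (λ { refl → inverseʳ π })
    adj-w′ : ∀ i → adj G (π ⟨$⟩ʳ (π ⟨$⟩ˡ w)) (π ⟨$⟩ʳ i)
                 ≡ (i == (π ⟨$⟩ˡ u) ∨ i == (π ⟨$⟩ˡ v))
    adj-w′ i rewrite inverseʳ π {w} = trans (adj-w (π ⟨$⟩ʳ i)) (cong₂ _∨_ (moved i u) (moved i v))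
    ¬uv′ : adj G (π ⟨$⟩ʳ (π ⟨$⟩ˡ u)) (π ⟨$⟩ʳ (π ⟨$⟩ˡ v)) ≡ false
    ¬uv′ rewrite inverseʳ π {u} | inverseʳ π {v} = ¬uv

suppressible-edges : ∀ {n} (G : Graph n) {w a b} → SuppressibleAt G w a b → Edge G w a × Edge G w b
suppressible-edges G {a = a} {b} (_ , adj-w , _) =
  trans (adj-w a) (cong (_∨ (a == b)) (==-refl a)) ,
  trans (adj-w b) (trans (cong ((b == a) ∨_) (==-refl b)) (∨-zeroʳ (b == a)))

module SuppressLast {m} (G : Graph (suc m)) {u v : Fin m}
                    (supp : SuppressibleAt G (fromℕ m) (inject₁ u) (inject₁ v)) where

  private
    L = fromℕ m
    u≢v : u ≢ v
    u≢v = proj₁ supp ∘ cong inject₁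
    ¬uv : adj G (inject₁ u) (inject₁ v) ≡ false
    ¬uv = proj₂ (proj₂ supp)

  adj-L : ∀ i → adj G L (inject₁ i) ≡ (i == u ∨ i == v)
  adj-L i = trans (proj₁ (proj₂ supp) (inject₁ i)) (cong₂ _∨_ (inject₁-== u) (inject₁-== v))
    where
    inject₁-== : ∀ a → (inject₁ i == inject₁ a) ≡ (i == a)
    inject₁-== a = ==-cong inject₁-injective (cong inject₁)

  L-u : Edge G L (inject₁ u)
  L-u = proj₁ (suppressible-edges G supp)

  L-v : Edge G L (inject₁ v)
  L-v = proj₂ (suppressible-edges G supp)

  L-neighbour : ∀ {j} → Edge G L (inject₁ j) → j ≡ u ⊎ j ≡ v
  L-neighbour {j} e with ∨-true⁻ (j == u) (trans (sym (adj-L j)) e)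
  ... | inj₁ j≡u = inj₁ (==⇒≡ j≡u)
  ... | inj₂ j≡v = inj₂ (==⇒≡ j≡v)

  isPair : Fin m → Fin m → Bool
  isPair i j = (i == u ∧ j == v) ∨ (i == v ∧ j == u)

  isPair-sym : ∀ i j → isPair i j ≡ isPair j i
  isPair-sym i j = trans (cong₂ _∨_ (∧-comm (i == u) (j == v)) (∧-comm (i == v) (j == u)))
                         (∨-comm (j == v ∧ i == u) (j == u ∧ i == v))

  isPair-irrefl : ∀ i → isPair i i ≡ false
  isPair-irrefl i with i ≟ u | i ≟ v
  ... | yes refl | yes refl = contradiction refl u≢v
  ... | yes _    | no _     = refl
  ... | no _     | yes _    = refl
  ... | no _     | no _     = refl

  isPair⁻ : ∀ i j → isPair i j ≡ true → (i ≡ u × j ≡ v) ⊎ (i ≡ v × j ≡ u)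
  isPair⁻ i j p with ∨-true⁻ (i == u ∧ j == v) p
  ... | inj₁ q = let i≡u , j≡v = ∧-true⁻ (i == u) q in inj₁ (==⇒≡ i≡u , ==⇒≡ j≡v)
  ... | inj₂ q = let i≡v , j≡u = ∧-true⁻ (i == v) q in inj₂ (==⇒≡ i≡v , ==⇒≡ j≡u)

  isPair-uv : isPair u v ≡ true
  isPair-uv rewrite ==-refl u | ==-refl v = refl

  isPair-vu : isPair v u ≡ true
  isPair-vu = trans (isPair-sym v u) isPair-uv

  suppressed : Graph m
  suppressed = record
    { adj   = λ i j → adj G (inject₁ i) (inject₁ j) ∨ isPair i j
    ; sym   = λ i j → cong₂ _∨_ (Graph.sym G (inject₁ i) (inject₁ j)) (isPair-sym i j)
    ; irref = λ i → cong₂ _∨_ (Graph.irref G (inject₁ i)) (isPair-irrefl i)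
    }

  kept-edge : ∀ {i j} → Edge G (inject₁ i) (inject₁ j) → Edge suppressed i j
  kept-edge {i} {j} e = cong (_∨ isPair i j) e

  pair-edge : ∀ {i j} → isPair i j ≡ true → Edge suppressed i j
  pair-edge {i} {j} p = trans (cong (adj G (inject₁ i) (inject₁ j) ∨_) p) (∨-zeroʳ _)

  suppressed-step : SubdivStep suppressed G
  suppressed-step = u , v , pair-edge isPair-uv , restore , adj-L
    where
    not-pair : ∀ {i j} → isPair i j ≡ true → adj G (inject₁ i) (inject₁ j) ≡ false
    not-pair {i} {j} p with isPair⁻ i j p
    ... | inj₁ (refl , refl) = ¬uv
    ... | inj₂ (refl , refl) = trans (Graph.sym G _ _) ¬uv
    restore′ : ∀ a p → (p ≡ true → a ≡ false) → a ≡ ((a ∨ p) ∧ not p)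
    restore′ true  true  h with () ← h refl
    restore′ false true  _ = refl
    restore′ true  false _ = refl
    restore′ false false _ = refl
    restore : ∀ i j → adj G (inject₁ i) (inject₁ j)
                      ≡ ((adj G (inject₁ i) (inject₁ j) ∨ isPair i j) ∧ not (isPair i j))
    restore i j = restore′ _ (isPair i j) not-pair

  -- The suppressed vertex is merged into u; branch sets of suppressed pull back along collapse.
  collapse : Fin (suc m) → Fin m
  collapse i with view i
  ... | ‵fromℕ      = u
  ... | ‵inject₁ j = j

  collapse-inject₁ : ∀ j → collapse (inject₁ j) ≡ j
  collapse-inject₁ j rewrite view-inject₁ j = refl

  collapse-L : collapse L ≡ u
  collapse-L rewrite view-fromℕ m = refl

  collapse-edge : ∀ {p q} → Edge G p q → collapse p ≡ collapse q ⊎ Edge suppressed (collapse p) (collapse q)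
  collapse-edge {p} {q} e with view p | view q
  ... | ‵fromℕ      | ‵fromℕ      = contradiction refl (edge-irrefl G e)
  ... | ‵inject₁ _ | ‵inject₁ _ = inj₂ (kept-edge e)
  ... | ‵fromℕ      | ‵inject₁ _ with L-neighbour e
  ...   | inj₁ refl = inj₁ refl
  ...   | inj₂ refl = inj₂ (pair-edge isPair-uv)
  collapse-edge {p} {q} e | ‵inject₁ _ | ‵fromℕ with L-neighbour (edge-sym G e)
  ...   | inj₁ refl = inj₁ refl
  ...   | inj₂ refl = inj₂ (pair-edge isPair-vu)

  suppressed-connected : Connected G → Connected suppressed
  suppressed-connected conn a b =
    subst₂ (WalkIn suppressed _) (collapse-inject₁ a) (collapse-inject₁ b)
      (walk-map collapse (λ _ → tt) collapse-step (conn (inject₁ a) (inject₁ b)))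
    where
    collapse-step : ∀ {p q} → ⊤ → ⊤ → Edge G p q →
                    WalkIn suppressed (λ _ → ⊤) (collapse p) (collapse q)
    collapse-step _ _ e with collapse-edge e
    ... | inj₁ same = subst (WalkIn suppressed _ _) same (here tt)
    ... | inj₂ e′   = step tt e′ (here tt)

  suppressed-minor : ∀ {h} {H : Graph h} → HasMinor suppressed H → HasMinor G H
  suppressed-minor {H = H} M = record
    { β         = β ∘ collapse
    ; nonempty  = λ y → let a , βa = nonempty y in inject₁ a , βι βa
    ; connected = connected′
    ; edges     = edges′
    }
    where
    open MinorModel M
    Class : Fin _ → Fin (suc m) → Set
    Class y p = β (collapse p) ≡ just y

    βι : ∀ {a y} → β a ≡ just y → Class y (inject₁ a)
    βι = trans (cong β (collapse-inject₁ _))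

    βL : ∀ {y} → β u ≡ just y → Class y L
    βL = trans (cong β collapse-L)

    lift-edge : ∀ {y i j} → β i ≡ just y → β j ≡ just y → Edge suppressed i j →
                WalkIn G (Class y) (inject₁ i) (inject₁ j)
    lift-edge {i = i} {j} βi βj e with ∨-true⁻ (adj G (inject₁ i) (inject₁ j)) e
    ... | inj₁ e′ = step (βι βi) e′ (here (βι βj))
    ... | inj₂ p with isPair⁻ i j p
    ...   | inj₁ (refl , refl) = step (βι βi) (edge-sym G L-u) (step (βL βi) L-v (here (βι βj)))
    ...   | inj₂ (refl , refl) = step (βι βi) (edge-sym G L-v) (step (βL βj) L-u (here (βι βj)))

    to-representative : ∀ {y} p → Class y p → WalkIn G (Class y) p (inject₁ (collapse p))
    to-representative p βp with view p
    ... | ‵inject₁ j = here (βι βp)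
    ... | ‵fromℕ      = step (βL βp) L-u (here (βι βp))

    connected′ : ∀ y p q → Class y p → Class y q → WalkIn G (Class y) p q
    connected′ y p q βp βq =
      walk-++ (to-representative p βp)
        (walk-++ (walk-map inject₁ βι lift-edge (connected y (collapse p) (collapse q) βp βq))
                 (walk-reverse (to-representative q βq)))

    edges′ : ∀ y z → Edge H y z → ∃ λ s → ∃ λ t → Class y s × Class z t × Edge G s t
    edges′ y z e with edges y z e
    ... | a , b , βa , βb , ab with ∨-true⁻ (adj G (inject₁ a) (inject₁ b)) ab
    ...   | inj₁ ab′ = inject₁ a , inject₁ b , βι βa , βι βb , ab′
    ...   | inj₂ p with isPair⁻ a b p
    ...     | inj₁ (refl , refl) = L , inject₁ v , βL βa , βι βb , L-v
    ...     | inj₂ (refl , refl) = inject₁ v , L , βι βa , βL βb , edge-sym G L-v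

  suppression : Suppression G
  suppression = record
    { graph = suppressed ; connected = suppressed-connected ; minor = suppressed-minor
    ; subdivision = λ H⊑ → sub H⊑ suppressed-step }

relabel-suppression : ∀ {m} (G : Graph (suc m)) (π : Permutation (suc m) (suc m)) →
                      Suppression (relabel G π) → Suppression G
relabel-suppression G π s = record
  { graph       = graph
  ; connected   = connected ∘ relabel-connected G π
  ; minor       = relabel-minor G π ∘ minor
  ; subdivision = λ H⊑ → iso (subdivision H⊑) (relabel-≅ G π)
  }
  where open Suppression s

suppressible-at-last : ∀ {m} (G : Graph (suc m)) {a b} → SuppressibleAt G (fromℕ m) a b →
                       ∃₂ λ u v → SuppressibleAt G (fromℕ m) (inject₁ u) (inject₁ v)
suppressible-at-last G {a} {b} supp with view a | view b
... | ‵fromℕ      | _          = contradiction refl (edge-irrefl G (proj₁ (suppressible-edges G supp)))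
... | ‵inject₁ _ | ‵fromℕ      = contradiction refl (edge-irrefl G (proj₂ (suppressible-edges G supp)))
... | ‵inject₁ u | ‵inject₁ v = u , v , supp

-- SubdivStep adds the new vertex last, so w is first moved there.
suppress : ∀ {m} (G : Graph (suc m)) → Suppressible G → Suppression G
suppress {m} G (w , u , v , supp) =
  let _ , _ , supp-last = suppressible-at-last G₂
        (subst (λ z → SuppressibleAt G₂ z (π ⟨$⟩ˡ u) (π ⟨$⟩ˡ v)) π⁻¹w≡L
               (relabel-suppressible G π supp))
  in relabel-suppression G π (SuppressLast.suppression G₂ supp-last)
  where
  π : Permutation (suc m) (suc m)
  π = transpose (fromℕ m) w
  G₂ = relabel G π
  π⁻¹w≡L : π ⟨$⟩ˡ w ≡ fromℕ m
  π⁻¹w≡L rewrite dec-true (w ≟ w) refl = refl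

module Neighbourhood {n} (G : Graph n) where

  VertexSet : Set
  VertexSet = Fin n → Bool

  infix 4 _∈_ _∉_ _⊆_

  _∈_ _∉_ : Fin n → VertexSet → Set
  i ∈ S = S i ≡ true
  i ∉ S = S i ≡ false

  _⊆_ : VertexSet → VertexSet → Set
  S ⊆ S′ = ∀ {i} → i ∈ S → i ∈ S′

  ∉? : (S : VertexSet) → Decidable (_∉ S)
  ∉? S i = S i ≟ᵇ false

  ∈⇒¬∉ : ∀ {S i} → i ∈ S → ¬ i ∉ S
  ∈⇒¬∉ i∈S i∉S with () ← trans (sym i∈S) i∉S

  ∈⊎∉ : ∀ S i → i ∈ S ⊎ i ∉ S
  ∈⊎∉ S i with S i
  ... | true  = inj₁ refl
  ... | false = inj₂ refl

  ∉-anti : ∀ {S S′} → S ⊆ S′ → ∀ {i} → i ∉ S′ → i ∉ S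
  ∉-anti {S′ = S′} S⊆S′ i∉S′ = ¬-not (λ i∈S → ∈⇒¬∉ {S′} (S⊆S′ i∈S) i∉S′)

  insert : Fin n → VertexSet → VertexSet
  insert v S i = S i ∨ does (i ≟ v)

  ∈-insert : ∀ {S} v → v ∈ insert v S
  ∈-insert {S} v rewrite dec-true (v ≟ v) refl = ∨-zeroʳ (S v)

  ⊆-insert : ∀ {S} v → S ⊆ insert v S
  ⊆-insert v i∈S rewrite i∈S = refl

  ∉-insert : ∀ {S i v} → i ∉ S → i ≢ v → i ∉ insert v S
  ∉-insert {i = i} {v} i∉S i≢v rewrite i∉S = dec-false (i ≟ v) i≢v

  insert-new : ∀ {S i v} → i ∈ insert v S → i ∉ S → i ≡ v
  insert-new {i = i} {v} i∈ i∉S rewrite i∉S with i ≟ v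
  ... | yes i≡v = i≡v

  Touches : VertexSet → Fin n → Set
  Touches S i = ∃ λ s → s ∈ S × Edge G s i

  touches? : ∀ S → Decidable (Touches S)
  touches? S i = any? λ s → (S s ≟ᵇ true) ×-dec (adj G s i ≟ᵇ true)

  Undiscovered Frontier : VertexSet → Fin n → Set
  Undiscovered S i = i ∉ S × ¬ Touches S i
  Frontier     S i = i ∉ S × Touches S i

  undiscovered? : ∀ S → Decidable (Undiscovered S)
  undiscovered? S i = ∉? S i ×-dec ¬? (touches? S i)

  frontier? : ∀ S → Decidable (Frontier S)
  frontier? S i = ∉? S i ×-dec touches? S i

  SeesUndiscovered : VertexSet → Fin n → Set
  SeesUndiscovered S i = ∃ λ z → Undiscovered S z × Edge G i z

  sees? : ∀ S → Decidable (SeesUndiscovered S)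
  sees? S i = any? λ z → undiscovered? S z ×-dec (adj G i z ≟ᵇ true)

  touches-mono : ∀ {S S′} → S ⊆ S′ → ∀ {i} → Touches S i → Touches S′ i
  touches-mono S⊆S′ (s , s∈S , e) = s , S⊆S′ s∈S , e

  undiscovered-anti : ∀ {S S′} → S ⊆ S′ → ∀ {i} → Undiscovered S′ i → Undiscovered S i
  undiscovered-anti {S} S⊆S′ (i∉S′ , ¬t) = ∉-anti {S} S⊆S′ i∉S′ , ¬t ∘ touches-mono S⊆S′

  sees-anti : ∀ {S S′} → S ⊆ S′ → ∀ {i} → SeesUndiscovered S′ i → SeesUndiscovered S i
  sees-anti S⊆S′ (z , uz , e) = z , undiscovered-anti S⊆S′ uz , e

  neighbour-∉-insert : ∀ {S i v} → i ∉ S → Edge G v i → i ∉ insert v S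
  neighbour-∉-insert {S} i∉S e = ∉-insert {S} i∉S (edge-irrefl G e ∘ sym)

  neighbour-of-undiscovered : ∀ {S v w} → Undiscovered S w → Edge G v w → v ∉ S
  neighbour-of-undiscovered (_ , ¬t) e = ¬-not (λ v∈S → ¬t (_ , v∈S , e))

  undiscovered≢frontier : ∀ {S v w} → Undiscovered S w → Frontier S v → w ≢ v
  undiscovered≢frontier (_ , ¬t) (_ , t) refl = ¬t t

  touches-discovered : ∀ {S v} → v ∉ S → ¬ Undiscovered S v → Touches S v
  touches-discovered {S} {v} v∉S ¬u = decidable-stable (touches? S v) (λ ¬t → ¬u (v∉S , ¬t))

  frontier-insert : ∀ {S c u} → c ∉ S → Edge G u c → Frontier (insert u S) c
  frontier-insert {S} {u = u} c∉S e = neighbour-∉-insert {S} c∉S e , u , ∈-insert {S} u , e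

  Reaches : Fin n → VertexSet → Set
  Reaches x S = ∀ {a} → a ∈ S → WalkIn G (_∈ S) x a

  reaches-insert : ∀ {x S v} → Reaches x S → Touches S v → Reaches x (insert v S)
  reaches-insert {S = S} {v} reach (s , s∈S , e) {a} a∈S′ with ∈⊎∉ S a
  ... | inj₁ a∈S = walk-weaken (⊆-insert {S} v) (reach a∈S)
  ... | inj₂ a∉S with refl ← insert-new {S} {a} {v} a∈S′ a∉S =
    walk-snoc (walk-weaken (⊆-insert {S} v) (reach s∈S)) e (∈-insert {S} v)

  weight : Bool → Bool → Bool → ℕ
  weight true  _     _     = 0
  weight false false _     = 1
  weight false true  true  = 3
  weight false true  false = 5

  potential : VertexSet → Fin n → ℕ
  potential S i = weight (S i) (does (touches? S i)) (does (sees? S i))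

  module _ {S : VertexSet} {i : Fin n} where

    potential-∈ : i ∈ S → potential S i ≡ 0
    potential-∈ i∈S rewrite i∈S = refl

    potential-undiscovered : Undiscovered S i → potential S i ≡ 1
    potential-undiscovered (i∉S , ¬t) rewrite i∉S | dec-false (touches? S i) ¬t = refl

    potential-live : Frontier S i → SeesUndiscovered S i → potential S i ≡ 3
    potential-live (i∉S , t) s
      rewrite i∉S | dec-true (touches? S i) t | dec-true (sees? S i) s = refl

    potential-dead : Frontier S i → ¬ SeesUndiscovered S i → potential S i ≡ 5
    potential-dead (i∉S , t) ¬s
      rewrite i∉S | dec-true (touches? S i) t | dec-false (sees? S i) ¬s = refl

    potential-frontier : Frontier S i → 3 ≤ potential S i
    potential-frontier (i∉S , t) rewrite i∉S | dec-true (touches? S i) t with does (sees? S i)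
    ... | true  = ≤-refl
    ... | false = s≤s (s≤s (s≤s z≤n))

    potential-∉ : i ∉ S → 1 ≤ potential S i
    potential-∉ i∉S rewrite i∉S with does (touches? S i) | does (sees? S i)
    ... | false | _     = ≤-refl
    ... | true  | true  = s≤s z≤n
    ... | true  | false = s≤s z≤n

    potential-≤5 : potential S i ≤ 5
    potential-≤5 with S i | does (touches? S i) | does (sees? S i)
    ... | true  | _     | _     = z≤n
    ... | false | false | _     = s≤s z≤n
    ... | false | true  | true  = s≤s (s≤s (s≤s z≤n))
    ... | false | true  | false = ≤-refl

  potential-mono : ∀ {S S′} → S ⊆ S′ → ∀ {i} → i ∉ S′ → potential S i ≤ potential S′ i
  potential-mono {S} {S′} S⊆S′ {i} i∉S′
    rewrite ∉-anti {S} S⊆S′ {i} i∉S′ | i∉S′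
    with touches? S i | touches? S′ i | sees? S i | sees? S′ i
  ... | no _  | no _    | _     | _      = ≤-refl
  ... | no _  | yes _   | _     | yes _  = s≤s z≤n
  ... | no _  | yes _   | _     | no _   = s≤s z≤n
  ... | yes t | no ¬t′  | _     | _      = contradiction (touches-mono S⊆S′ t) ¬t′
  ... | yes _ | yes _   | yes _ | yes _  = ≤-refl
  ... | yes _ | yes _   | yes _ | no _   = s≤s (s≤s (s≤s z≤n))
  ... | yes _ | yes _   | no ¬s | yes s′ = contradiction (sees-anti S⊆S′ s′) ¬s
  ... | yes _ | yes _   | no _  | no _   = ≤-refl

  gain-touched : ∀ {S S′ c} → Undiscovered S c → Frontier S′ c → potential S c + 2 ≤ potential S′ c
  gain-touched {S} {S′} {c} uc fc rewrite potential-undiscovered {S} {c} uc = potential-frontier {S′} fc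

  gain-exhausted : ∀ {S S′ c} → Undiscovered S c → Frontier S′ c → ¬ SeesUndiscovered S′ c →
                   potential S c + 4 ≤ potential S′ c
  gain-exhausted {S} {S′} {c} uc fc ¬s
    rewrite potential-undiscovered {S} {c} uc | potential-dead {S′} {c} fc ¬s = ≤-refl

  gain-dying : ∀ {S S′ c} → Frontier S c → SeesUndiscovered S c →
               Frontier S′ c → ¬ SeesUndiscovered S′ c →
               potential S c + 2 ≤ potential S′ c
  gain-dying {S} {S′} {c} fc s fc′ ¬s′
    rewrite potential-live {S} {c} fc s | potential-dead {S′} {c} fc′ ¬s′ = ≤-refl

  star-minor : ∀ {x S r} → x ∈ S → Reaches x S → r ≤ count (frontier? S) → HasMinor G (Star r)
  star-minor {x} {S} {r} x∈S reach r≤ = record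
    { β = β ; nonempty = nonempty ; connected = connected ; edges = edges }
    where
    leaves = pick (frontier? S) r≤
    ℓ = proj₁ leaves
    ℓ-inj = proj₁ (proj₂ leaves)
    ℓ-frontier = proj₂ (proj₂ leaves)

    leaf : Fin n → Maybe (Fin (suc r))
    leaf v with any? (λ k → ℓ k ≟ v)
    ... | yes (k , _) = just (suc k)
    ... | no _        = nothing

    β : Fin n → Maybe (Fin (suc r))
    β v = if S v then just zero else leaf v

    β-∈ : ∀ {v} → v ∈ S → β v ≡ just zero
    β-∈ v∈S rewrite v∈S = refl

    β-ℓ : ∀ k → β (ℓ k) ≡ just (suc k)
    β-ℓ k rewrite proj₁ (ℓ-frontier k) with any? (λ k′ → ℓ k′ ≟ ℓ k)
    ... | yes (k′ , e) rewrite ℓ-inj e = refl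
    ... | no ¬leaf     = contradiction (k , refl) ¬leaf

    β-zero⁻ : ∀ {v} → β v ≡ just zero → v ∈ S
    β-zero⁻ {v} βv with S v | any? (λ k → ℓ k ≟ v)
    ... | true  | _ = refl
    β-zero⁻ {v} () | false | yes _
    β-zero⁻ {v} () | false | no _

    β-suc⁻ : ∀ {v k} → β v ≡ just (suc k) → ℓ k ≡ v
    β-suc⁻ {v} βv with S v | any? (λ k → ℓ k ≟ v)
    β-suc⁻ {v} refl | false | yes (k , ℓk≡v) = ℓk≡v

    nonempty : ∀ y → ∃ λ v → β v ≡ just y
    nonempty zero    = x , β-∈ x∈S
    nonempty (suc k) = ℓ k , β-ℓ k

    connected : ∀ y u v → β u ≡ just y → β v ≡ just y → WalkIn G (λ w → β w ≡ just y) u v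
    connected zero u v βu βv =
      walk-weaken β-∈ (walk-++ (walk-reverse (reach (β-zero⁻ βu))) (reach (β-zero⁻ βv)))
    connected (suc k) u v βu βv with β-suc⁻ βu | β-suc⁻ βv
    ... | refl | refl = here βu

    edges : ∀ y z → Edge (Star r) y z → ∃ λ u → ∃ λ v → β u ≡ just y × β v ≡ just z × Edge G u v
    edges zero (suc k) _ =
      let s , s∈S , e = proj₂ (ℓ-frontier k) in s , ℓ k , β-∈ s∈S , β-ℓ k , e
    edges (suc k) zero _ =
      let s , s∈S , e = proj₂ (ℓ-frontier k) in ℓ k , s , β-ℓ k , β-∈ s∈S , edge-sym G e

module Growth {n} (G : Graph n) (connected : Connected G) (x : Fin n) where

  open Neighbourhood G

  record Invariant (S : VertexSet) : Set where
    field
      root    : x ∈ S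
      reaches : Reaches x S
      large   : n ≤ suc (sum (potential S))

  open Invariant

  Progress : VertexSet → Set
  Progress S = ∃ λ S′ → Invariant S′ × count (∉? S′) < count (∉? S)

  FrontierEdge : VertexSet → Fin n → Fin n → Set
  FrontierEdge S v w = Frontier S v × Undiscovered S w × Edge G v w

  data Gain (S S′ : VertexSet) : Set where
    once  : ∀ {a} → potential S a + 4 ≤ potential S′ a → Gain S S′
    twice : ∀ {a b} → a ≢ b →
            potential S a + 2 ≤ potential S′ a → potential S b + 2 ≤ potential S′ b → Gain S S′

  -- Absorbing v (weight at most 3) and w (weight at most 1) loses at most 4, which a Gain pays for.
  module _ {S S′ v w} (S⊆S′ : S ⊆ S′) (new : ∀ {i} → i ∈ S′ → i ∉ S → i ≡ v ⊎ i ≡ w)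
           (loss-v : potential S v ≤ 3) (loss-w : potential S w ≤ 1) where

    loss : Fin n → ℕ
    loss i = δ v 3 i + δ w 1 i

    sum-loss : sum loss ≡ 4
    sum-loss = trans (∑-distrib-+ (δ v 3) (δ w 1)) (cong₂ _+_ (sum-δ v 3) (sum-δ w 1))

    potential-baseline : ∀ i → potential S i ≤ potential S′ i + loss i
    potential-baseline i with ∈⊎∉ S′ i | ∈⊎∉ S i
    ... | inj₂ i∉S′ | _ = ≤-trans (potential-mono S⊆S′ i∉S′) (m≤m+n _ _)
    ... | inj₁ _    | inj₁ i∈S = ≤-trans (≤-reflexive (potential-∈ i∈S)) z≤n
    ... | inj₁ i∈S′ | inj₂ i∉S with new i∈S′ i∉S
    ...   | inj₁ refl rewrite δ-self i 3 =
            ≤-trans loss-v (≤-trans (m≤m+n 3 _) (m≤n+m _ _))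
    ...   | inj₂ refl rewrite δ-self i 1 =
            ≤-trans loss-w (≤-trans (m≤n+m 1 (δ v 3 i)) (m≤n+m _ (potential S′ i)))

    potential-exchange : Gain S S′ → sum (potential S) ≤ sum (potential S′)
    potential-exchange (once {a} gain) =
      sum-exchange pointwise (≤-reflexive (trans sum-loss (sym (sum-δ a 4))))
      where
      pointwise : ∀ i → potential S i + δ a 4 i ≤ potential S′ i + loss i
      pointwise i with i ≟ a
      ... | yes refl = ≤-trans gain (m≤m+n _ _)
      ... | no _     = ≤-trans (≤-reflexive (+-identityʳ _)) (potential-baseline i)
    potential-exchange (twice {a} {b} a≢b gain-a gain-b) =
      sum-exchange pointwise (≤-reflexive (trans sum-loss (sym sum-gain)))
      where
      sum-gain : sum (λ i → δ a 2 i + δ b 2 i) ≡ 4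
      sum-gain = trans (∑-distrib-+ (δ a 2) (δ b 2)) (cong₂ _+_ (sum-δ a 2) (sum-δ b 2))
      pointwise : ∀ i → potential S i + (δ a 2 i + δ b 2 i) ≤ potential S′ i + loss i
      pointwise i with i ≟ a | i ≟ b
      ... | yes refl | yes refl = contradiction refl a≢b
      ... | yes refl | no _     = ≤-trans gain-a (m≤m+n _ _)
      ... | no _     | yes refl = ≤-trans gain-b (m≤m+n _ _)
      ... | no _     | no _     = ≤-trans (≤-reflexive (+-identityʳ _)) (potential-baseline i)

  advance : ∀ {S S′ v w} → Invariant S → FrontierEdge S v w → S ⊆ S′ →
            (∀ {i} → i ∈ S′ → i ∉ S → i ≡ v ⊎ i ≡ w) → v ∈ S′ → Reaches x S′ →
            Gain S S′ → Progress S
  advance {S} {S′} inv (fv , uw , vw) S⊆S′ new v∈S′ reach′ gain = S′ , inv′ , fewer-outside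
    where
    exchange = potential-exchange S⊆S′ new
      (≤-reflexive (potential-live fv (_ , uw , vw))) (≤-reflexive (potential-undiscovered uw)) gain
    inv′ : Invariant S′
    inv′ = record { root = S⊆S′ (root inv) ; reaches = reach′ ; large = ≤-trans (large inv) (s≤s exchange) }
    fewer-outside : count (∉? S′) < count (∉? S)
    fewer-outside = count-mono-< (∉? S′) (∉? S) (∉-anti {S} S⊆S′) (proj₁ fv) (∈⇒¬∉ {S′} v∈S′)

  absorb₁ : ∀ {S v w} → Invariant S → FrontierEdge S v w → Gain S (insert v S) → Progress S
  absorb₁ {S} {v} inv fe@((_ , touches-v) , _) =
    advance inv fe (⊆-insert {S} v) (λ i∈S′ i∉S → inj₁ (insert-new {S} i∈S′ i∉S)) (∈-insert {S} v)
      (reaches-insert (reaches inv) touches-v)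

  absorb₂ : ∀ {S v w} → Invariant S → FrontierEdge S v w → Gain S (insert w (insert v S)) → Progress S
  absorb₂ {S} {v} {w} inv fe@((_ , touches-v) , _ , vw) =
    advance inv fe (⊆-insert {insert v S} w ∘ ⊆-insert {S} v) new (⊆-insert {insert v S} w (∈-insert {S} v))
      (reaches-insert (reaches-insert (reaches inv) touches-v) (v , ∈-insert {S} v , vw))
    where
    new : ∀ {i} → i ∈ insert w (insert v S) → i ∉ S → i ≡ v ⊎ i ≡ w
    new {i} i∈S″ i∉S with ∈⊎∉ (insert v S) i
    ... | inj₁ i∈S′ = inj₁ (insert-new {S} i∈S′ i∉S)
    ... | inj₂ i∉S′ = inj₂ (insert-new {insert v S} i∈S″ i∉S′)

  OtherUndiscoveredNeighbour : VertexSet → Fin n → Fin n → Set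
  OtherUndiscoveredNeighbour S v w = ∃ λ b → Undiscovered S b × Edge G v b × b ≢ w

  other? : ∀ S v w → Dec (OtherUndiscoveredNeighbour S v w)
  other? S v w = any? λ b → undiscovered? S b ×-dec (adj G v b ≟ᵇ true) ×-dec ¬? (b ≟ w)

  only-undiscovered-neighbour : ∀ {S v w b} → ¬ OtherUndiscoveredNeighbour S v w →
                                Undiscovered S b → Edge G v b → b ≡ w
  only-undiscovered-neighbour {w = w} {b} ¬other ub vb =
    decidable-stable (b ≟ w) (λ b≢w → ¬other (b , ub , vb , b≢w))

  third? : ∀ w u v → Dec (∃ λ y → Edge G w y × y ≢ u × y ≢ v)
  third? w u v = any? λ y → (adj G w y ≟ᵇ true) ×-dec ¬? (y ≟ u) ×-dec ¬? (y ≟ v)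

  fork-gain : ∀ {S v w b} → Undiscovered S w → Undiscovered S b → Edge G v w → Edge G v b → b ≢ w →
              Gain S (insert v S)
  fork-gain uw ub vw vb b≢w =
    twice (b≢w ∘ sym) (gain-touched uw (frontier-insert (proj₁ uw) vw))
                      (gain-touched ub (frontier-insert (proj₁ ub) vb))

  gain-beyond : ∀ {S v w c} → Frontier S v → Undiscovered S c → Edge G w c →
                potential S c + 2 ≤ potential (insert w (insert v S)) c
  gain-beyond {S} fv uc wc =
    gain-touched uc (frontier-insert (∉-insert {S} (proj₁ uc) (undiscovered≢frontier uc fv)) wc)

  module _ {S v w} (inv : Invariant S) (fe : FrontierEdge S v w)
           (¬fork : ¬ OtherUndiscoveredNeighbour S v w) where

    private
      fv = proj₁ fe
      uw = proj₁ (proj₂ fe)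
      vw = proj₂ (proj₂ fe)

    -- y is on the frontier; unless it has a second undiscovered neighbour, absorbing v and w
    -- takes its last one, so its weight rises from 3 to 5.
    grow-third : ∀ {x′ y} → Undiscovered S x′ → Edge G w x′ → Edge G w y → y ≢ v → y ≢ x′ →
                 ¬ OtherUndiscoveredNeighbour S w x′ → Progress S
    grow-third {x′} {y} ux′ wx′ wy y≢v y≢x′ ¬branch = by-cases (other? S y w)
      where
      S″ = insert w (insert v S)
      yw : Edge G y w
      yw = edge-sym G wy
      y∉S : y ∉ S
      y∉S = neighbour-of-undiscovered uw yw
      fy : Frontier S y
      fy = y∉S , touches-discovered y∉S (λ uy → y≢x′ (only-undiscovered-neighbour ¬branch uy wy))
      fy″ : Frontier S″ y
      fy″ = frontier-insert (∉-insert {S} y∉S y≢v) wy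
      by-cases : Dec (OtherUndiscoveredNeighbour S y w) → Progress S
      by-cases (yes (b , ub , yb , b≢w)) = absorb₁ inv (fy , uw , yw) (fork-gain uw ub yw yb b≢w)
      by-cases (no ¬fork′) =
        absorb₂ inv fe (twice (y≢x′ ∘ sym) (gain-beyond fv ux′ wx′)
                                          (gain-dying fy (w , uw , yw) fy″ ¬sees″))
        where
        ¬sees″ : ¬ SeesUndiscovered S″ y
        ¬sees″ (z , uz″ , yz)
          with refl ← only-undiscovered-neighbour ¬fork′
                        (undiscovered-anti {S} (⊆-insert {insert v S} w ∘ ⊆-insert {S} v) uz″) yz
          = ∈⇒¬∉ {S″} (∈-insert {insert v S} w) (proj₁ uz″)

    degree-two : ∀ {x′} → Undiscovered S x′ → Edge G w x′ →
                 ¬ (∃ λ y → Edge G w y × y ≢ v × y ≢ x′) →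
                 SuppressibleAt G w v x′
    degree-two {x′} ux′ wx′ ¬third = undiscovered≢frontier ux′ fv ∘ sym , adj-w , ¬-not ¬vx′
      where
      adj-w : ∀ i → adj G w i ≡ (i == v ∨ i == x′)
      adj-w i with i ≟ v | i ≟ x′
      ... | yes refl | _        = edge-sym G vw
      ... | no _     | yes refl = wx′
      ... | no i≢v   | no i≢x′  = ¬-not (λ wi → ¬third (i , wi , i≢v , i≢x′))
      ¬vx′ : ¬ Edge G v x′
      ¬vx′ vx′ = edge-irrefl G wx′ (sym (only-undiscovered-neighbour ¬fork ux′ vx′))

    grow-branch : ∀ {x′} → Undiscovered S x′ → Edge G w x′ → Suppressible G ⊎ Progress S
    grow-branch {x′} ux′ wx′ with other? S w x′
    ... | yes (b , ub , wb , b≢x′) =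
          inj₂ (absorb₂ inv fe (twice (b≢x′ ∘ sym) (gain-beyond fv ux′ wx′) (gain-beyond fv ub wb)))
    ... | no ¬branch with third? w v x′
    ...   | yes (y , wy , y≢v , y≢x′) = inj₂ (grow-third ux′ wx′ wy y≢v y≢x′ ¬branch)
    ...   | no ¬third = inj₁ (w , v , x′ , degree-two ux′ wx′ ¬third)

    grow-through : Suppressible G ⊎ Progress S
    grow-through with sees? S w
    ... | yes (x′ , ux′ , wx′) = grow-branch ux′ wx′
    ... | no dead-end =
          inj₂ (absorb₁ inv fe (once (gain-exhausted uw (frontier-insert (proj₁ uw) vw)
                                                        (dead-end ∘ sees-anti (⊆-insert {S} v)))))

  grow : ∀ {S v w} → Invariant S → FrontierEdge S v w → Suppressible G ⊎ Progress S
  grow {S} {v} {w} inv fe@(_ , uw , vw) with other? S v w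
  ... | yes (b , ub , vb , b≢w) = inj₂ (absorb₁ inv fe (fork-gain uw ub vw vb b≢w))
  ... | no ¬fork                = grow-through inv fe ¬fork

  frontier-edge : ∀ {S u} → Invariant S → Undiscovered S u → ∃₂ λ v w → FrontierEdge S v w
  frontier-edge {S} {u} inv uu =
    let v , w , ¬uv , uw , vw =
          walk-crossing (undiscovered? S) (connected x u) (∈⇒¬∉ {S} (root inv) ∘ proj₁) uu
        v∉S = neighbour-of-undiscovered uw vw
    in v , w , (v∉S , touches-discovered v∉S ¬uv) , uw , vw

  potential-bound : ∀ {S} → ¬ ∃ (Undiscovered S) → sum (potential S) ≤ 5 * count (frontier? S)
  potential-bound {S} none = begin
    sum (potential S)                          ≤⟨ sum-mono (λ i → pointwise i (frontier? S i)) ⟩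
    sum (λ i → 5 * indicator (frontier? S i))  ≡⟨ *-distribˡ-sum 5 (indicator ∘ frontier? S) ⟨
    5 * count (frontier? S)                    ∎
    where
    open ≤-Reasoning
    pointwise : ∀ i (fi? : Dec (Frontier S i)) → potential S i ≤ 5 * indicator fi?
    pointwise i (yes _) = potential-≤5
    pointwise i (no ¬fi) with ∈⊎∉ S i
    ... | inj₁ i∈S = ≤-reflexive (potential-∈ i∈S)
    ... | inj₂ i∉S = contradiction (i∉S , touches-discovered i∉S (λ ui → none (i , ui))) ¬fi

  S₀ : VertexSet
  S₀ i = does (i ≟ x)

  invariant₀ : Invariant S₀
  invariant₀ = record { root = x∈S₀ ; reaches = reaches₀ ; large = large₀ }
    where
    x∈S₀ : x ∈ S₀
    x∈S₀ = dec-true (x ≟ x) refl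
    reaches₀ : Reaches x S₀
    reaches₀ {a} a∈S₀ with a ≟ x
    ... | yes refl = here x∈S₀
    ... | no _ with () ← a∈S₀
    pointwise : ∀ i → 1 ≤ potential S₀ i + δ x 1 i
    pointwise i = by-cases (i ≟ x)
      where
      by-cases : Dec (i ≡ x) → 1 ≤ potential S₀ i + δ x 1 i
      by-cases (yes refl) = ≤-trans (≤-reflexive (sym (δ-self x 1))) (m≤n+m _ _)
      by-cases (no i≢x)   = begin
        1                        ≤⟨ potential-∉ (dec-false (i ≟ x) i≢x) ⟩
        potential S₀ i           ≡⟨ +-identityʳ _ ⟨
        potential S₀ i + 0       ≡⟨ cong (potential S₀ i +_) (δ-other 1 i≢x) ⟨
        potential S₀ i + δ x 1 i ∎
        where open ≤-Reasoning
    large₀ : n ≤ suc (sum (potential S₀))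
    large₀ = begin
      n                                   ≡⟨ sum-ones n ⟨
      sum {n} (λ _ → 1)                   ≤⟨ sum-mono pointwise ⟩
      sum (λ i → potential S₀ i + δ x 1 i) ≡⟨ ∑-distrib-+ (potential S₀) (δ x 1) ⟩
      sum (potential S₀) + sum (δ x 1)    ≡⟨ cong (sum (potential S₀) +_) (sum-δ x 1) ⟩
      sum (potential S₀) + 1              ≡⟨ +-comm _ 1 ⟩
      suc (sum (potential S₀))            ∎
      where open ≤-Reasoning

  LargeFrontier : Set
  LargeFrontier = ∃ λ S → x ∈ S × Reaches x S × n ≤ suc (5 * count (frontier? S))

  grow-fully : ∀ {S} → Invariant S → Acc _<_ (count (∉? S)) → Suppressible G ⊎ LargeFrontier
  grow-fully {S} inv (acc smaller) with any? (undiscovered? S)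
  ... | no none = inj₂ (S , root inv , reaches inv , ≤-trans (large inv) (s≤s (potential-bound none)))
  ... | yes (u , uu) with grow inv (proj₂ (proj₂ (frontier-edge inv uu)))
  ...   | inj₁ suppressible      = inj₁ suppressible
  ...   | inj₂ (_ , inv′ , fewer) = grow-fully inv′ (smaller fewer)

  suppressible-or-large-frontier : Suppressible G ⊎ LargeFrontier
  suppressible-or-large-frontier = grow-fully invariant₀ (<-wellFounded _)

subdivision-bound : ∀ r n (G : Graph n) → Connected G → ¬ HasMinor G (Star r) →
                    ∃ λ m → ∃ λ (H : Graph m) → m ≤ 5 * r × SubdivisionOf H G
subdivision-bound r zero    G _    _     = 0 , G , z≤n , base
subdivision-bound r (suc m) G conn ¬star with Growth.suppressible-or-large-frontier G conn zero
... | inj₁ supp =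
  let open Suppression (suppress G supp)
      k , H , k≤ , H⊑ = subdivision-bound r m graph (connected conn) (¬star ∘ minor)
  in k , H , k≤ , subdivision H⊑
... | inj₂ (S , x∈S , reaches , large) with suc m ≤? 5 * r
...   | yes small = suc m , G , small , base
...   | no big    = contradiction (Neighbourhood.star-minor G x∈S reaches r≤frontier) ¬star
  where
  r≤frontier : r ≤ count (Neighbourhood.frontier? G S)
  r≤frontier = *-cancelˡ-≤ 5 (≤-pred (≤-trans (≰⇒> big) large))

lemma2 : Σ (ℕ → ℕ) λ s →
    (∃ λ c → ∃ λ N → ∀ r → N ≤ r → s r ≤ c * r) ×
    (∀ (r n : ℕ) (G : Graph n) → Connected G → ¬ HasMinor G (Star r) →
      ∃ λ m → ∃ λ (H : Graph m) → m ≤ s r × SubdivisionOf H G)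
lemma2 = (5 *_) , (5 , 0 , λ _ _ → ≤-refl) , subdivision-bound
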